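{- Let $\mathcal M$ be the $\mathcal L_{ar}$-structure with universe $M = \mathbb N \cup \{\omega\}$ in which $S,+,\cdot$ on $\mathbb N$ are standard, $S\omega = \omega$, $x + \omega = \omega + x = \omega$ for all $x\in M$, $0 \cdot \omega = \omega \cdot 0 = 0$, and $x \cdot \omega = \omega \cdot x = \omega$ for all $x \ne 0$, and in which $x \leqslant y$ holds iff there is $r\in M$ with $r + x = y$. Let $t(x, y_1, \dots, y_n)$ be an $\mathcal L_{ar}$-term and fix $y_1, \dots, y_n \in M$. Then either $t(x,\vec y)$ is constant in $x$ (i.e. there is $z \in M$ with $t(x, \vec y) = z$ for all $x \in M$), or $t(\omega, \vec y) = \omega$; and in the latter case $t(x, \vec y) \geqslant x$ for all $x \in M$.
   Context: $\mathcal L_{ar} = (0, S, +, \cdot, \leqslant)$ is the language of arithmetic. -}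

module Defs where

open import Data.Nat as ℕ using (ℕ)
open import Data.Fin using (Fin)
open import Data.Product using (∃)
open import Relation.Binary.PropositionalEquality using (_≡_)

data M : Set where
  fin : ℕ → M
  ω   : M

𝟘 : M
𝟘 = fin 0

S : M → M
S (fin n) = fin (ℕ.suc n)
S ω       = ω

_⊕_ : M → M → M
fin m ⊕ fin n = fin (m ℕ.+ n)
fin _ ⊕ ω     = ω
ω     ⊕ _     = ω

_⊗_ : M → M → M
fin m       ⊗ fin n       = fin (m ℕ.* n)
fin ℕ.zero  ⊗ ω           = fin 0
fin (ℕ.suc _) ⊗ ω         = ω
ω           ⊗ fin ℕ.zero  = fin 0
ω           ⊗ fin (ℕ.suc _) = ω
ω           ⊗ ω           = ω

_≤M_ : M → M → Set
x ≤M y = ∃ λ r → r ⊕ x ≡ y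

data Term (k : ℕ) : Set where
  var  : Fin k → Term k
  zer  : Term k
  succ : Term k → Term k
  _+ₜ_ : Term k → Term k → Term k
  _*ₜ_ : Term k → Term k → Term k

⟦_⟧ : ∀ {k} → Term k → (Fin k → M) → M
⟦ var i ⟧ ρ    = ρ i
⟦ zer ⟧ ρ      = 𝟘
⟦ succ t ⟧ ρ   = S (⟦ t ⟧ ρ)
⟦ t +ₜ u ⟧ ρ   = ⟦ t ⟧ ρ ⊕ ⟦ u ⟧ ρ
⟦ t *ₜ u ⟧ ρ   = ⟦ t ⟧ ρ ⊗ ⟦ u ⟧ ρ

-- assignment for t(x, y₁,…,yₙ): variable 0 is x, variable (suc i) is yᵢ
_∷ₐ_ : ∀ {n} → M → (Fin n → M) → Fin (ℕ.suc n) → M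
(x ∷ₐ ys) Fin.zero    = x
(x ∷ₐ ys) (Fin.suc i) = ys i

{-# OPTIONS --safe #-}
-- By induction on t, every term function x ↦ t(x, y⃗) is either constant or
-- dominating: it sends ω to ω and lies above the identity. Dominating
-- functions stay dominating under S, under addition of anything, and under
-- multiplication by anything except the constant 0, which collapses the
-- product to the constant 0.
module Submission where

open import Defs
open import Data.Nat using (ℕ; suc; zero; _≤_; z≤n)
open import Data.Nat.Properties
  using (≤-refl; ≤-trans; n≤1+n; m≤m+n; m≤m*n; m∸n+n≡m; +-comm; *-comm; *-zeroʳ)
open import Data.Fin using (Fin)
open import Data.Product using (∃; _×_; _,_)
open import Data.Sum using (_⊎_; inj₁; inj₂)
open import Relation.Nullary using (Dec; yes; no)
open import Relation.Binary.PropositionalEquality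
  using (_≡_; _≢_; refl; sym; trans; subst; cong; cong₂)

-- A syntax-directed presentation of ≤M; only its soundness ≼⇒≤M is needed.
infix 4 _≼_

data _≼_ : M → M → Set where
  fin≤fin : ∀ {a b} → a ≤ b → fin a ≼ fin b
  _≼ω     : ∀ x → x ≼ ω

≼⇒≤M : ∀ {x y} → x ≼ y → x ≤M y
≼⇒≤M (fin≤fin a≤b) = fin _ , cong fin (m∸n+n≡m a≤b)
≼⇒≤M (x ≼ω)        = ω , refl

≼-refl : ∀ x → x ≼ x
≼-refl (fin a) = fin≤fin ≤-refl
≼-refl ω       = ω ≼ω

≼-trans : ∀ {x y z} → x ≼ y → y ≼ z → x ≼ z
≼-trans (fin≤fin p) (fin≤fin q) = fin≤fin (≤-trans p q)
≼-trans {x} _       (_ ≼ω)      = x ≼ω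

𝟘-≼ : ∀ x → 𝟘 ≼ x
𝟘-≼ (fin b) = fin≤fin z≤n
𝟘-≼ ω       = 𝟘 ≼ω

≼𝟘⇒≡𝟘 : ∀ {x} → x ≼ 𝟘 → x ≡ 𝟘
≼𝟘⇒≡𝟘 (fin≤fin z≤n) = refl

≼-S : ∀ x → x ≼ S x
≼-S (fin a) = fin≤fin (n≤1+n a)
≼-S ω       = ω ≼ω

≼-⊕ʳ : ∀ x y → x ≼ x ⊕ y
≼-⊕ʳ (fin a) (fin b) = fin≤fin (m≤m+n a b)
≼-⊕ʳ (fin a) ω       = fin a ≼ω
≼-⊕ʳ ω       y       = ω ≼ω

≼-⊗ʳ : ∀ x {y} → y ≢ 𝟘 → x ≼ x ⊗ y
≼-⊗ʳ (fin a)       {fin zero}    y≢𝟘 with () ← y≢𝟘 refl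
≼-⊗ʳ (fin a)       {fin (suc b)} _   = fin≤fin (m≤m*n a (suc b))
≼-⊗ʳ (fin zero)    {ω}           _   = 𝟘-≼ 𝟘
≼-⊗ʳ (fin (suc a)) {ω}           _   = fin (suc a) ≼ω
≼-⊗ʳ ω             {fin zero}    y≢𝟘 with () ← y≢𝟘 refl
≼-⊗ʳ ω             {fin (suc b)} _   = ω ≼ω
≼-⊗ʳ ω             {ω}           _   = ω ≼ω

≟𝟘 : (x : M) → Dec (x ≡ 𝟘)
≟𝟘 (fin zero)    = yes refl
≟𝟘 (fin (suc a)) = no λ ()
≟𝟘 ω             = no λ ()

≼-⊗ : ∀ {x y z} → x ≼ y → x ≼ z → x ≼ y ⊗ z
≼-⊗ {z = z} x≼y x≼z with ≟𝟘 z
... | yes refl rewrite ≼𝟘⇒≡𝟘 x≼z = 𝟘-≼ _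
... | no z≢𝟘   = ≼-trans x≼y (≼-⊗ʳ _ z≢𝟘)

⊕-comm : ∀ x y → x ⊕ y ≡ y ⊕ x
⊕-comm (fin a) (fin b) = cong fin (+-comm a b)
⊕-comm (fin a) ω       = refl
⊕-comm ω       (fin b) = refl
⊕-comm ω       ω       = refl

⊗-comm : ∀ x y → x ⊗ y ≡ y ⊗ x
⊗-comm (fin a)       (fin b)       = cong fin (*-comm a b)
⊗-comm (fin zero)    ω             = refl
⊗-comm (fin (suc a)) ω             = refl
⊗-comm ω             (fin zero)    = refl
⊗-comm ω             (fin (suc b)) = refl
⊗-comm ω             ω             = refl

⊗-𝟘 : ∀ x → x ⊗ 𝟘 ≡ 𝟘
⊗-𝟘 (fin a) = cong fin (*-zeroʳ a)
⊗-𝟘 ω       = refl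

ω-⊗ : ∀ {y} → y ≢ 𝟘 → ω ⊗ y ≡ ω
ω-⊗ {fin zero}    y≢𝟘 with () ← y≢𝟘 refl
ω-⊗ {fin (suc b)} _   = refl
ω-⊗ {ω}           _   = refl

Constant : (M → M) → Set
Constant f = ∃ λ z → ∀ x → f x ≡ z

Dominating : (M → M) → Set
Dominating f = (f ω ≡ ω) × (∀ x → x ≼ f x)

Dichotomy : (M → M) → Set
Dichotomy f = Constant f ⊎ Dominating f

dichotomy-resp : ∀ {f g} → (∀ x → f x ≡ g x) → Dichotomy f → Dichotomy g
dichotomy-resp f≗g (inj₁ (z , f≗z)) = inj₁ (z , λ x → trans (sym (f≗g x)) (f≗z x))
dichotomy-resp f≗g (inj₂ (fω≡ω , dom)) =
  inj₂ (trans (sym (f≗g ω)) fω≡ω , λ x → subst (x ≼_) (f≗g x) (dom x))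

dichotomy-S : ∀ {f} → Dichotomy f → Dichotomy (λ x → S (f x))
dichotomy-S (inj₁ (z , f≗z))     = inj₁ (S z , λ x → cong S (f≗z x))
dichotomy-S (inj₂ (fω≡ω , dom)) =
  inj₂ (cong S fω≡ω , λ x → ≼-trans (dom x) (≼-S _))

dominating-⊕ : ∀ (f g : M → M) → Dominating f → Dominating (λ x → f x ⊕ g x)
dominating-⊕ f g (fω≡ω , dom) =
  cong (_⊕ g ω) fω≡ω , λ x → ≼-trans (dom x) (≼-⊕ʳ _ (g x))

dichotomy-⊕ : ∀ {f g} → Dichotomy f → Dichotomy g → Dichotomy (λ x → f x ⊕ g x)
dichotomy-⊕ {f} {g} _ (inj₂ dg) =
  dichotomy-resp (λ x → ⊕-comm (g x) (f x)) (inj₂ (dominating-⊕ g f dg))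
dichotomy-⊕ {f} {g} (inj₂ df) (inj₁ _) = inj₂ (dominating-⊕ f g df)
dichotomy-⊕ (inj₁ (z , f≗z)) (inj₁ (z′ , g≗z′)) =
  inj₁ (z ⊕ z′ , λ x → cong₂ _⊕_ (f≗z x) (g≗z′ x))

dichotomy-⊗-const : ∀ {f} → Dominating f → ∀ z → Dichotomy (λ x → f x ⊗ z)
dichotomy-⊗-const _ z with ≟𝟘 z
dichotomy-⊗-const {f} _ z | yes refl = inj₁ (𝟘 , λ x → ⊗-𝟘 (f x))
dichotomy-⊗-const (fω≡ω , dom) z | no z≢𝟘 =
  inj₂ (trans (cong (_⊗ z) fω≡ω) (ω-⊗ z≢𝟘) , λ x → ≼-trans (dom x) (≼-⊗ʳ _ z≢𝟘))

dichotomy-⊗ : ∀ {f g} → Dichotomy f → Dichotomy g → Dichotomy (λ x → f x ⊗ g x)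
dichotomy-⊗ (inj₁ (z , f≗z)) (inj₁ (z′ , g≗z′)) =
  inj₁ (z ⊗ z′ , λ x → cong₂ _⊗_ (f≗z x) (g≗z′ x))
dichotomy-⊗ (inj₂ (fω≡ω , domf)) (inj₂ (gω≡ω , domg)) =
  inj₂ (cong₂ _⊗_ fω≡ω gω≡ω , λ x → ≼-⊗ (domf x) (domg x))
dichotomy-⊗ {f} (inj₂ df) (inj₁ (z , g≗z)) =
  dichotomy-resp (λ x → cong (f x ⊗_) (sym (g≗z x))) (dichotomy-⊗-const df z)
dichotomy-⊗ {g = g} (inj₁ (z , f≗z)) (inj₂ dg) =
  dichotomy-resp (λ x → trans (⊗-comm (g x) z) (cong (_⊗ g x) (sym (f≗z x))))
                 (dichotomy-⊗-const dg z)

term-dichotomy : ∀ {n} (ys : Fin n → M) (t : Term (suc n)) →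
  Dichotomy (λ x → ⟦ t ⟧ (x ∷ₐ ys))
term-dichotomy ys (var Fin.zero)    = inj₂ (refl , ≼-refl)
term-dichotomy ys (var (Fin.suc i)) = inj₁ (ys i , λ _ → refl)
term-dichotomy ys zer               = inj₁ (𝟘 , λ _ → refl)
term-dichotomy ys (succ t)          = dichotomy-S (term-dichotomy ys t)
term-dichotomy ys (t +ₜ u)          =
  dichotomy-⊕ (term-dichotomy ys t) (term-dichotomy ys u)
term-dichotomy ys (t *ₜ u)          =
  dichotomy-⊗ (term-dichotomy ys t) (term-dichotomy ys u)

lemma3p1 : (n : ℕ) (t : Term (suc n)) (ys : Fin n → M) →
    (∃ λ z → ∀ x → ⟦ t ⟧ (x ∷ₐ ys) ≡ z)
      ⊎ ((⟦ t ⟧ (ω ∷ₐ ys) ≡ ω) × (∀ x → x ≤M ⟦ t ⟧ (x ∷ₐ ys)))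
lemma3p1 n t ys with term-dichotomy ys t
... | inj₁ constant          = inj₁ constant
... | inj₂ (tω≡ω , dominates) = inj₂ (tω≡ω , λ x → ≼⇒≤M (dominates x))
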